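{- Let $D=xy\frac{\partial}{\partial x}+x^2\frac{\partial}{\partial y}$ be the derivation on Laurent polynomials in $x,y$ with $D(x)=xy$, $D(y)=x^2$, and for a Laurent polynomial $f$ let $\mathrm{Gen}(f,t)=\sum_{n\ge0}D^n(f)\frac{t^n}{n!}$. Then $$\mathrm{Gen}(x^{ -1},t)=\frac{\sqrt{y^2-x^2}\cosh\big(t\sqrt{y^2-x^2}\big)-y\sinh\big(t\sqrt{y^2-x^2}\big)}{x\sqrt{y^2-x^2}}.$$
   Context: The right-hand side is a formal power series in $t$: with $s=\sqrt{y^2-x^2}$, $\cosh(ts)=\sum_{n\ge0}s^{2n}\frac{t^{2n}}{(2n)!}$ and $\sinh(ts)/s=\sum_{n\ge0}s^{2n}\frac{t^{2n+1}}{(2n+1)!}$, so only even powers of $s$, i.e. powers of $y^2-x^2$, occur. -}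

module Defs where

open import Data.Nat using (ℕ; zero; suc)
open import Data.Integer using (ℤ; +_; -[1+_]; _+_; _*_; -_; _≟_)
open import Data.List using (List; []; _∷_; _++_; map; concatMap; foldr)
open import Data.Product using (_×_; _,_)
open import Data.Bool using (if_then_else_; _∧_)
open import Relation.Nullary.Decidable using (⌊_⌋)
open import Relation.Binary.PropositionalEquality using (_≡_)

-- Laurent polynomials in x, y over ℤ.
-- A monomial (c , i , j) stands for  c · x^i · y^j  with i j ∈ ℤ;
-- a Laurent polynomial is a finite formal sum (list) of monomials.
Mono : Set
Mono = ℤ × ℤ × ℤ

LP : Set
LP = List Mono

coeff : LP → ℤ → ℤ → ℤ
coeff []                  i j = + 0
coeff ((c , a , b) ∷ ms)  i j =
  (if ⌊ a ≟ i ⌋ ∧ ⌊ b ≟ j ⌋ then c else + 0) + coeff ms i j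

infix 4 _≈_
_≈_ : LP → LP → Set
p ≈ q = ∀ i j → coeff p i j ≡ coeff q i j

0L : LP
0L = []

1L : LP
1L = (+ 1 , + 0 , + 0) ∷ []

infixl 6 _⊕_ _⊖_
infixl 7 _⊗_

_⊕_ : LP → LP → LP
p ⊕ q = p ++ q

⊝_ : LP → LP
⊝ p = map (λ { (c , a , b) → (- c , a , b) }) p

_⊖_ : LP → LP → LP
p ⊖ q = p ⊕ (⊝ q)

monoMul : Mono → Mono → Mono
monoMul (c , a , b) (d , a' , b') = (c * d , a + a' , b + b')

_⊗_ : LP → LP → LP
p ⊗ q = concatMap (λ m → map (monoMul m) q) p

X Y X⁻¹ : LP
X   = (+ 1 , + 1 , + 0) ∷ []
Y   = (+ 1 , + 0 , + 1) ∷ []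
X⁻¹ = (+ 1 , -[1+ 0 ] , + 0) ∷ []

-- The derivation D = x y ∂/∂x + x² ∂/∂y :
-- D(c x^i y^j) = c i x^i y^(j+1) + c j x^(i+2) y^(j-1), extended additively.
DMono : Mono → LP
DMono (c , i , j) = (c * i , i , j + + 1) ∷ (c * j , i + + 2 , j + -[1+ 0 ]) ∷ []

D : LP → LP
D p = concatMap DMono p

Dⁿ : ℕ → LP → LP
Dⁿ zero    f = f
Dⁿ (suc n) f = D (Dⁿ n f)

-- Exponential generating functions Σ a_n t^n/n! with coefficients in
-- Laurent polynomials are represented by their sequence (a_n) of
-- coefficients of t^n/n!.
EGF : Set
EGF = ℕ → LP

Gen : LP → EGF
Gen f n = Dⁿ n f

S² : LP
S² = Y ⊗ Y ⊖ X ⊗ X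

-- cosh(t s) = Σ s^(2n) t^(2n)/(2n)!
coshTS : EGF
coshTS zero          = 1L
coshTS (suc zero)    = 0L
coshTS (suc (suc n)) = S² ⊗ coshTS n

-- sinh(t s)/s = Σ s^(2n) t^(2n+1)/(2n+1)!
sinhTS/S : EGF
sinhTS/S zero          = 0L
sinhTS/S (suc zero)    = 1L
sinhTS/S (suc (suc n)) = S² ⊗ sinhTS/S n

-- (s cosh(ts) − y sinh(ts)) / (x s)  =  x⁻¹ (cosh(ts) − y · sinh(ts)/s)
RHS : EGF
RHS n = X⁻¹ ⊗ (coshTS n ⊖ Y ⊗ sinhTS/S n)

-- D²(x⁻¹) = (y² − x²) x⁻¹, and D annihilates s² = y² − x² (D(y²) = 2x²y = D(x²)), so D
-- commutes with multiplication by s². Hence D^(n+2)(x⁻¹) = s² Dⁿ(x⁻¹), and the coefficients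
-- of the right-hand side obey the same recursion, since the coefficients of cosh(ts) and
-- sinh(ts)/s get multiplied by s² every two steps. The two sequences agree for n = 0, 1.
{-# OPTIONS --safe #-}
module Submission where

open import Defs
open import Data.Bool using (true; false; if_then_else_; _∧_)
open import Data.Integer using (ℤ; +_; -[1+_]; _+_; _*_; -_; _-_; _≟_)
open import Data.Integer.Properties using (+-identityˡ; +-assoc; +-comm; *-zeroʳ; *-comm; neg-distrib-+; *-distribˡ-+)
open import Data.Integer.Tactic.RingSolver using (solve-∀)
open import Data.List using ([]; _∷_; _++_; map)
open import Data.Nat using (zero; suc)
open import Data.Product using (_,_)
open import Function.Bundles using (_⇔_; mk⇔)
open import Function.Construct.Identity using (⇔-id)
open import Level using (0ℓ)
open import Relation.Binary.Bundles using (Setoid)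
open import Relation.Binary.PropositionalEquality
open import Relation.Nullary using (Dec; yes; no)
open import Relation.Nullary.Decidable using (⌊_⌋; does-⇔; isYes≗does)
import Relation.Binary.Reasoning.Setoid as SetoidReasoning

≈-refl : ∀ {p} → p ≈ p
≈-refl i j = refl

≈-sym : ∀ {p q} → p ≈ q → q ≈ p
≈-sym p≈q i j = sym (p≈q i j)

≈-trans : ∀ {p q r} → p ≈ q → q ≈ r → p ≈ r
≈-trans p≈q q≈r i j = trans (p≈q i j) (q≈r i j)

≈-setoid : Setoid 0ℓ 0ℓ
≈-setoid = record
  { Carrier       = LP
  ; _≈_           = _≈_
  ; isEquivalence = record
    { refl  = λ {p} → ≈-refl {p}
    ; sym   = λ {p q} → ≈-sym {p} {q}
    ; trans = λ {p q r} → ≈-trans {p} {q} {r}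
    }
  }

module ≈-Reasoning = SetoidReasoning ≈-setoid

⌊⌋-⇔ : ∀ {P Q : Set} (P? : Dec P) (Q? : Dec Q) → P ⇔ Q → ⌊ P? ⌋ ≡ ⌊ Q? ⌋
⌊⌋-⇔ P? Q? P⇔Q = trans (isYes≗does P?) (trans (does-⇔ P⇔Q P? Q?) (sym (isYes≗does Q?)))

i+j≡k⇔i≡k-j : ∀ i j k → (i + j ≡ k) ⇔ (i ≡ k - j)
i+j≡k⇔i≡k-j i j k = mk⇔ (λ e → trans (cancel i j) (cong (_- j) e)) (λ e → trans (cong (_+ j) e) (uncancel k j))
  where
  cancel : ∀ i j → i ≡ i + j - j
  cancel = solve-∀
  uncancel : ∀ k j → k - j + j ≡ k
  uncancel = solve-∀

i+j≡k⇔j≡k-i : ∀ i j k → (i + j ≡ k) ⇔ (j ≡ k - i)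
i+j≡k⇔j≡k-i i j k rewrite +-comm i j = i+j≡k⇔i≡k-j j i k

-- coeff (m ∷ p) i j unfolds to coeffₘ m i j + coeff p i j.
coeffₘ : Mono → ℤ → ℤ → ℤ
coeffₘ (c , a , b) i j = if ⌊ a ≟ i ⌋ ∧ ⌊ b ≟ j ⌋ then c else + 0

coeffₘ-cong : ∀ c {a b i j a′ b′ i′ j′} → (a ≡ i) ⇔ (a′ ≡ i′) → (b ≡ j) ⇔ (b′ ≡ j′) →
              coeffₘ (c , a , b) i j ≡ coeffₘ (c , a′ , b′) i′ j′
coeffₘ-cong c {a} {b} {i} {j} {a′} {b′} {i′} {j′} ea eb
  rewrite ⌊⌋-⇔ (a ≟ i) (a′ ≟ i′) ea | ⌊⌋-⇔ (b ≟ j) (b′ ≟ j′) eb = refl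

coeffₘ-scale : ∀ {c d} a b i j k → (a ≡ i → b ≡ j → c ≡ k * d) →
               coeffₘ (c , a , b) i j ≡ k * coeffₘ (d , a , b) i j
coeffₘ-scale a b i j k c≡kd with a ≟ i | b ≟ j
... | yes a≡i | yes b≡j = c≡kd a≡i b≡j
... | yes _   | no _    = sym (*-zeroʳ k)
... | no _    | _       = sym (*-zeroʳ k)

coeffₘ-map : ∀ (f : ℤ → ℤ) → f (+ 0) ≡ + 0 →
             ∀ c a b i j → coeffₘ (f c , a , b) i j ≡ f (coeffₘ (c , a , b) i j)
coeffₘ-map f f0≡0 c a b i j with ⌊ a ≟ i ⌋ ∧ ⌊ b ≟ j ⌋
... | true  = refl
... | false = sym f0≡0

coeff-++ : ∀ p q i j → coeff (p ++ q) i j ≡ coeff p i j + coeff q i j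
coeff-++ []                q i j = sym (+-identityˡ _)
coeff-++ ((c , a , b) ∷ p) q i j rewrite coeff-++ p q i j = sym (+-assoc (coeffₘ (c , a , b) i j) _ _)

coeff-⊝ : ∀ p i j → coeff (⊝ p) i j ≡ - coeff p i j
coeff-⊝ []                i j = refl
coeff-⊝ ((c , a , b) ∷ p) i j = begin
  coeffₘ (- c , a , b) i j + coeff (⊝ p) i j  ≡⟨ cong₂ _+_ (coeffₘ-map -_ refl c a b i j) (coeff-⊝ p i j) ⟩
  - coeffₘ (c , a , b) i j + - coeff p i j    ≡⟨ neg-distrib-+ (coeffₘ (c , a , b) i j) _ ⟨
  - coeff ((c , a , b) ∷ p) i j               ∎
  where open ≡-Reasoning

coeff-⊖ : ∀ p q i j → coeff (p ⊖ q) i j ≡ coeff p i j - coeff q i j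
coeff-⊖ p q i j = trans (coeff-++ p (⊝ q) i j) (cong (λ x → coeff p i j + x) (coeff-⊝ q i j))

coeff-∷-zero : ∀ a b p i j → coeff ((+ 0 , a , b) ∷ p) i j ≡ coeff p i j
coeff-∷-zero a b p i j =
  trans (cong (_+ coeff p i j) (coeffₘ-map (λ _ → + 0) refl (+ 0) a b i j)) (+-identityˡ _)

coeff-map-monoMul : ∀ c a b q i j → coeff (map (monoMul (c , a , b)) q) i j ≡ c * coeff q (i - a) (j - b)
coeff-map-monoMul c a b []                  i j = sym (*-zeroʳ c)
coeff-map-monoMul c a b ((d , a′ , b′) ∷ q) i j = begin
  coeffₘ (c * d , a + a′ , b + b′) i j + coeff (map (monoMul (c , a , b)) q) i j
    ≡⟨ cong₂ _+_ (coeffₘ-cong (c * d) (i+j≡k⇔j≡k-i a a′ i) (i+j≡k⇔j≡k-i b b′ j)) (coeff-map-monoMul c a b q i j) ⟩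
  coeffₘ (c * d , a′ , b′) (i - a) (j - b) + c * coeff q (i - a) (j - b)
    ≡⟨ cong (_+ c * coeff q (i - a) (j - b)) (coeffₘ-scale a′ b′ (i - a) (j - b) c (λ _ _ → refl)) ⟩
  c * coeffₘ (d , a′ , b′) (i - a) (j - b) + c * coeff q (i - a) (j - b)
    ≡⟨ *-distribˡ-+ c _ _ ⟨
  c * coeff ((d , a′ , b′) ∷ q) (i - a) (j - b)
    ∎
  where open ≡-Reasoning

coeff-∷-⊗ : ∀ c a b p q i j → coeff (((c , a , b) ∷ p) ⊗ q) i j ≡ c * coeff q (i - a) (j - b) + coeff (p ⊗ q) i j
coeff-∷-⊗ c a b p q i j =
  trans (coeff-++ (map (monoMul (c , a , b)) q) (p ⊗ q) i j) (cong (_+ coeff (p ⊗ q) i j) (coeff-map-monoMul c a b q i j))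

coeff-D : ∀ p i j → coeff (D p) i j ≡ i * coeff p i (j - + 1) + (j + + 1) * coeff p (i - + 2) (j + + 1)
coeff-D []                i j = sym (cong₂ _+_ (*-zeroʳ i) (*-zeroʳ (j + + 1)))
coeff-D ((c , a , b) ∷ p) i j = begin
  coeffₘ (c * a , a , b + + 1) i j + (coeffₘ (c * b , a + + 2 , b + -[1+ 0 ]) i j + coeff (D p) i j)
    ≡⟨ cong₂ _+_ ∂x-term (cong₂ _+_ ∂y-term (coeff-D p i j)) ⟩
  i * A + ((j + + 1) * B + (i * coeff p i (j - + 1) + (j + + 1) * coeff p (i - + 2) (j + + 1)))
    ≡⟨ regroup i A (j + + 1) B _ _ ⟩
  i * (A + coeff p i (j - + 1)) + (j + + 1) * (B + coeff p (i - + 2) (j + + 1))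
    ∎
  where
  open ≡-Reasoning
  A = coeffₘ (c , a , b) i (j - + 1)
  B = coeffₘ (c , a , b) (i - + 2) (j + + 1)
  ∂x-term : coeffₘ (c * a , a , b + + 1) i j ≡ i * A
  ∂x-term = trans (coeffₘ-cong (c * a) (⇔-id _) (i+j≡k⇔i≡k-j b (+ 1) j))
                  (coeffₘ-scale a b i (j - + 1) i (λ a≡i _ → trans (*-comm c a) (cong (_* c) a≡i)))
  -- j - -[1+ 0 ] reduces to j + + 1.
  ∂y-term : coeffₘ (c * b , a + + 2 , b + -[1+ 0 ]) i j ≡ (j + + 1) * B
  ∂y-term = trans (coeffₘ-cong (c * b) (i+j≡k⇔i≡k-j a (+ 2) i) (i+j≡k⇔i≡k-j b -[1+ 0 ] j))
                  (coeffₘ-scale a b (i - + 2) (j + + 1) (j + + 1) (λ _ b≡j+1 → trans (*-comm c b) (cong (_* c) b≡j+1)))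
  regroup : ∀ i A k B P Q → i * A + (k * B + (i * P + k * Q)) ≡ i * (A + P) + k * (B + Q)
  regroup = solve-∀

coeff-S²⊗ : ∀ q i j → coeff (S² ⊗ q) i j ≡ coeff q i (j - + 2) - coeff q (i - + 2) j
coeff-S²⊗ q i j = begin
  coeff (S² ⊗ q) i j
    ≡⟨ coeff-∷-⊗ (+ 1) (+ 0) (+ 2) ((-[1+ 0 ] , + 2 , + 0) ∷ []) q i j ⟩
  + 1 * coeff q (i - + 0) (j - + 2) + coeff (((-[1+ 0 ] , + 2 , + 0) ∷ []) ⊗ q) i j
    ≡⟨ cong (λ x → + 1 * coeff q (i - + 0) (j - + 2) + x) (coeff-∷-⊗ -[1+ 0 ] (+ 2) (+ 0) [] q i j) ⟩
  + 1 * coeff q (i - + 0) (j - + 2) + (-[1+ 0 ] * coeff q (i - + 2) (j - + 0) + + 0)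
    ≡⟨ cong₂ (λ u v → + 1 * coeff q u (j - + 2) + (-[1+ 0 ] * coeff q (i - + 2) v + + 0)) (i-0≡i i) (i-0≡i j) ⟩
  + 1 * coeff q i (j - + 2) + (-[1+ 0 ] * coeff q (i - + 2) j + + 0)
    ≡⟨ simplify (coeff q i (j - + 2)) (coeff q (i - + 2) j) ⟩
  coeff q i (j - + 2) - coeff q (i - + 2) j
    ∎
  where
  open ≡-Reasoning
  i-0≡i : ∀ i → i - + 0 ≡ i
  i-0≡i = solve-∀
  simplify : ∀ A B → + 1 * A + (-[1+ 0 ] * B + + 0) ≡ A - B
  simplify = solve-∀

⊗-zeroʳ : ∀ p → p ⊗ [] ≡ []
⊗-zeroʳ []      = refl
⊗-zeroʳ (_ ∷ p) = ⊗-zeroʳ p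

coeff-⊗-++ : ∀ p q r i j → coeff (p ⊗ (q ++ r)) i j ≡ coeff (p ⊗ q) i j + coeff (p ⊗ r) i j
coeff-⊗-++ []                q r i j = refl
coeff-⊗-++ ((c , a , b) ∷ p) q r i j = begin
  coeff (((c , a , b) ∷ p) ⊗ (q ++ r)) i j
    ≡⟨ coeff-∷-⊗ c a b p (q ++ r) i j ⟩
  c * coeff (q ++ r) (i - a) (j - b) + coeff (p ⊗ (q ++ r)) i j
    ≡⟨ cong₂ (λ u v → c * u + v) (coeff-++ q r (i - a) (j - b)) (coeff-⊗-++ p q r i j) ⟩
  c * (coeff q (i - a) (j - b) + coeff r (i - a) (j - b)) + (coeff (p ⊗ q) i j + coeff (p ⊗ r) i j)
    ≡⟨ regroup c _ _ _ _ ⟩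
  (c * coeff q (i - a) (j - b) + coeff (p ⊗ q) i j) + (c * coeff r (i - a) (j - b) + coeff (p ⊗ r) i j)
    ≡⟨ cong₂ _+_ (coeff-∷-⊗ c a b p q i j) (coeff-∷-⊗ c a b p r i j) ⟨
  coeff (((c , a , b) ∷ p) ⊗ q) i j + coeff (((c , a , b) ∷ p) ⊗ r) i j
    ∎
  where
  open ≡-Reasoning
  regroup : ∀ c Q R P₁ P₂ → c * (Q + R) + (P₁ + P₂) ≡ (c * Q + P₁) + (c * R + P₂)
  regroup = solve-∀

coeff-⊗-map-monoMul : ∀ c a b p q i j →
                      coeff (p ⊗ map (monoMul (c , a , b)) q) i j ≡ c * coeff (p ⊗ q) (i - a) (j - b)
coeff-⊗-map-monoMul c a b []                  q i j = sym (*-zeroʳ c)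
coeff-⊗-map-monoMul c a b ((d , a′ , b′) ∷ p) q i j = begin
  coeff (((d , a′ , b′) ∷ p) ⊗ map (monoMul (c , a , b)) q) i j
    ≡⟨ coeff-∷-⊗ d a′ b′ p (map (monoMul (c , a , b)) q) i j ⟩
  d * coeff (map (monoMul (c , a , b)) q) (i - a′) (j - b′) + coeff (p ⊗ map (monoMul (c , a , b)) q) i j
    ≡⟨ cong₂ (λ u v → d * u + v) (coeff-map-monoMul c a b q (i - a′) (j - b′)) (coeff-⊗-map-monoMul c a b p q i j) ⟩
  d * (c * coeff q (i - a′ - a) (j - b′ - b)) + c * coeff (p ⊗ q) (i - a) (j - b)
    ≡⟨ cong₂ (λ u v → d * (c * coeff q u v) + c * coeff (p ⊗ q) (i - a) (j - b)) (i-j-k≡i-k-j i a′ a) (i-j-k≡i-k-j j b′ b) ⟩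
  d * (c * coeff q (i - a - a′) (j - b - b′)) + c * coeff (p ⊗ q) (i - a) (j - b)
    ≡⟨ regroup c d _ _ ⟩
  c * (d * coeff q (i - a - a′) (j - b - b′) + coeff (p ⊗ q) (i - a) (j - b))
    ≡⟨ cong (c *_) (coeff-∷-⊗ d a′ b′ p q (i - a) (j - b)) ⟨
  c * coeff (((d , a′ , b′) ∷ p) ⊗ q) (i - a) (j - b)
    ∎
  where
  open ≡-Reasoning
  i-j-k≡i-k-j : ∀ i j k → i - j - k ≡ i - k - j
  i-j-k≡i-k-j = solve-∀
  regroup : ∀ c d Q P → d * (c * Q) + c * P ≡ c * (d * Q + P)
  regroup = solve-∀

x⊗yz≈y⊗xz : ∀ p q r → p ⊗ (q ⊗ r) ≈ q ⊗ (p ⊗ r)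
x⊗yz≈y⊗xz []                q r i j = cong (λ s → coeff s i j) (sym (⊗-zeroʳ q))
x⊗yz≈y⊗xz ((c , a , b) ∷ p) q r i j = begin
  coeff (((c , a , b) ∷ p) ⊗ (q ⊗ r)) i j
    ≡⟨ coeff-∷-⊗ c a b p (q ⊗ r) i j ⟩
  c * coeff (q ⊗ r) (i - a) (j - b) + coeff (p ⊗ (q ⊗ r)) i j
    ≡⟨ cong₂ _+_ (sym (coeff-⊗-map-monoMul c a b q r i j)) (x⊗yz≈y⊗xz p q r i j) ⟩
  coeff (q ⊗ map (monoMul (c , a , b)) r) i j + coeff (q ⊗ (p ⊗ r)) i j
    ≡⟨ coeff-⊗-++ q (map (monoMul (c , a , b)) r) (p ⊗ r) i j ⟨
  coeff (q ⊗ (((c , a , b) ∷ p) ⊗ r)) i j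
    ∎
  where open ≡-Reasoning

⊗-distribˡ-⊖ : ∀ p q r → p ⊗ (q ⊖ r) ≈ p ⊗ q ⊖ p ⊗ r
⊗-distribˡ-⊖ []                q r i j = refl
⊗-distribˡ-⊖ ((c , a , b) ∷ p) q r i j = begin
  coeff (((c , a , b) ∷ p) ⊗ (q ⊖ r)) i j
    ≡⟨ coeff-∷-⊗ c a b p (q ⊖ r) i j ⟩
  c * coeff (q ⊖ r) (i - a) (j - b) + coeff (p ⊗ (q ⊖ r)) i j
    ≡⟨ cong₂ (λ u v → c * u + v) (coeff-⊖ q r (i - a) (j - b))
             (trans (⊗-distribˡ-⊖ p q r i j) (coeff-⊖ (p ⊗ q) (p ⊗ r) i j)) ⟩
  c * (coeff q (i - a) (j - b) - coeff r (i - a) (j - b)) + (coeff (p ⊗ q) i j - coeff (p ⊗ r) i j)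
    ≡⟨ regroup c _ _ _ _ ⟩
  (c * coeff q (i - a) (j - b) + coeff (p ⊗ q) i j) - (c * coeff r (i - a) (j - b) + coeff (p ⊗ r) i j)
    ≡⟨ cong₂ _-_ (coeff-∷-⊗ c a b p q i j) (coeff-∷-⊗ c a b p r i j) ⟨
  coeff (((c , a , b) ∷ p) ⊗ q) i j - coeff (((c , a , b) ∷ p) ⊗ r) i j
    ≡⟨ coeff-⊖ (((c , a , b) ∷ p) ⊗ q) (((c , a , b) ∷ p) ⊗ r) i j ⟨
  coeff (((c , a , b) ∷ p) ⊗ q ⊖ ((c , a , b) ∷ p) ⊗ r) i j
    ∎
  where
  open ≡-Reasoning
  regroup : ∀ c Q R P₁ P₂ → c * (Q - R) + (P₁ - P₂) ≡ (c * Q + P₁) - (c * R + P₂)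
  regroup = solve-∀

⊗-congʳ : ∀ p {q r} → q ≈ r → p ⊗ q ≈ p ⊗ r
⊗-congʳ []                q≈r i j = refl
⊗-congʳ ((c , a , b) ∷ p) {q} {r} q≈r i j = begin
  coeff (((c , a , b) ∷ p) ⊗ q) i j
    ≡⟨ coeff-∷-⊗ c a b p q i j ⟩
  c * coeff q (i - a) (j - b) + coeff (p ⊗ q) i j
    ≡⟨ cong₂ (λ u v → c * u + v) (q≈r (i - a) (j - b)) (⊗-congʳ p q≈r i j) ⟩
  c * coeff r (i - a) (j - b) + coeff (p ⊗ r) i j
    ≡⟨ coeff-∷-⊗ c a b p r i j ⟨
  coeff (((c , a , b) ∷ p) ⊗ r) i j
    ∎
  where open ≡-Reasoning

⊖-cong : ∀ {p p′ q q′} → p ≈ p′ → q ≈ q′ → p ⊖ q ≈ p′ ⊖ q′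
⊖-cong {p} {p′} {q} {q′} p≈p′ q≈q′ i j =
  trans (coeff-⊖ p q i j) (trans (cong₂ _-_ (p≈p′ i j) (q≈q′ i j)) (sym (coeff-⊖ p′ q′ i j)))

D-cong : ∀ {p q} → p ≈ q → D p ≈ D q
D-cong {p} {q} p≈q i j = trans (coeff-D p i j)
  (trans (cong₂ (λ u v → i * u + (j + + 1) * v) (p≈q _ _) (p≈q _ _)) (sym (coeff-D q i j)))

Dⁿ-cong : ∀ n {p q} → p ≈ q → Dⁿ n p ≈ Dⁿ n q
Dⁿ-cong zero    p≈q = p≈q
Dⁿ-cong (suc n) {p} {q} p≈q = D-cong {Dⁿ n p} {Dⁿ n q} (Dⁿ-cong n p≈q)

D-S²⊗ : ∀ p → D (S² ⊗ p) ≈ S² ⊗ D p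
D-S²⊗ p i j = begin
  coeff (D (S² ⊗ p)) i j
    ≡⟨ coeff-D (S² ⊗ p) i j ⟩
  i * coeff (S² ⊗ p) i (j - + 1) + (j + + 1) * coeff (S² ⊗ p) (i - + 2) (j + + 1)
    ≡⟨ cong₂ (λ u v → i * u + (j + + 1) * v) (coeff-S²⊗ p i (j - + 1)) (coeff-S²⊗ p (i - + 2) (j + + 1)) ⟩
  i * (P i (j - + 1 - + 2) - P (i - + 2) (j - + 1)) + (j + + 1) * (P (i - + 2) (j + + 1 - + 2) - P (i - + 2 - + 2) (j + + 1))
    ≡⟨ cong₂ (λ u v → i * (P i u - P (i - + 2) (j - + 1)) + (j + + 1) * (P (i - + 2) v - P (i - + 2 - + 2) (j + + 1)))
             (j-1-2≡j-2-1 j) (j+1-2≡j-1 j) ⟩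
  i * (P i (j - + 2 - + 1) - P (i - + 2) (j - + 1)) + (j + + 1) * (P (i - + 2) (j - + 1) - P (i - + 2 - + 2) (j + + 1))
    ≡⟨ regroup i j _ _ _ ⟩
  i * P i (j - + 2 - + 1) + (j - + 2 + + 1) * P (i - + 2) (j - + 1)
    - ((i - + 2) * P (i - + 2) (j - + 1) + (j + + 1) * P (i - + 2 - + 2) (j + + 1))
    ≡⟨ cong (λ v → i * P i (j - + 2 - + 1) + (j - + 2 + + 1) * P (i - + 2) v
                   - ((i - + 2) * P (i - + 2) (j - + 1) + (j + + 1) * P (i - + 2 - + 2) (j + + 1)))
            (j-2+1≡j-1 j) ⟨
  i * P i (j - + 2 - + 1) + (j - + 2 + + 1) * P (i - + 2) (j - + 2 + + 1)
    - ((i - + 2) * P (i - + 2) (j - + 1) + (j + + 1) * P (i - + 2 - + 2) (j + + 1))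
    ≡⟨ cong₂ _-_ (coeff-D p i (j - + 2)) (coeff-D p (i - + 2) j) ⟨
  coeff (D p) i (j - + 2) - coeff (D p) (i - + 2) j
    ≡⟨ coeff-S²⊗ (D p) i j ⟨
  coeff (S² ⊗ D p) i j
    ∎
  where
  open ≡-Reasoning
  P = coeff p
  j-1-2≡j-2-1 : ∀ j → j - + 1 - + 2 ≡ j - + 2 - + 1
  j-1-2≡j-2-1 = solve-∀
  j+1-2≡j-1 : ∀ j → j + + 1 - + 2 ≡ j - + 1
  j+1-2≡j-1 = solve-∀
  j-2+1≡j-1 : ∀ j → j - + 2 + + 1 ≡ j - + 1
  j-2+1≡j-1 = solve-∀
  regroup : ∀ i j A B C → i * (A - B) + (j + + 1) * (B - C) ≡ i * A + (j - + 2 + + 1) * B - ((i - + 2) * B + (j + + 1) * C)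
  regroup = solve-∀

Dⁿ-S²⊗ : ∀ n p → Dⁿ n (S² ⊗ p) ≈ S² ⊗ Dⁿ n p
Dⁿ-S²⊗ zero    p = ≈-refl {S² ⊗ p}
Dⁿ-S²⊗ (suc n) p = ≈-trans {D (Dⁿ n (S² ⊗ p))} {D (S² ⊗ Dⁿ n p)} {S² ⊗ D (Dⁿ n p)}
  (D-cong {Dⁿ n (S² ⊗ p)} {S² ⊗ Dⁿ n p} (Dⁿ-S²⊗ n p)) (D-S²⊗ (Dⁿ n p))

Dⁿ-suc : ∀ n f → Dⁿ (suc n) f ≡ Dⁿ n (D f)
Dⁿ-suc zero    f = refl
Dⁿ-suc (suc n) f = cong D (Dⁿ-suc n f)

DX⁻¹≈RHS1 : D X⁻¹ ≈ RHS 1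
DX⁻¹≈RHS1 i j = cong (λ x → coeffₘ (-[1+ 0 ] , -[1+ 0 ] , + 1) i j + x) (coeff-∷-zero (+ 1) -[1+ 0 ] [] i j)

DDX⁻¹≈S²⊗X⁻¹ : D (D X⁻¹) ≈ S² ⊗ X⁻¹
DDX⁻¹≈S²⊗X⁻¹ i j =
  cong (λ x → coeffₘ (+ 1 , -[1+ 0 ] , + 2) i j + (coeffₘ (-[1+ 0 ] , + 1 , + 0) i j + x))
       (trans (coeff-∷-zero (+ 1) (+ 0) ((+ 0 , + 3 , -[1+ 1 ]) ∷ []) i j) (coeff-∷-zero (+ 3) -[1+ 1 ] [] i j))

RHS-step : ∀ n → RHS (suc (suc n)) ≈ S² ⊗ RHS n
RHS-step n = begin
  X⁻¹ ⊗ (S² ⊗ c ⊖ Y ⊗ (S² ⊗ s))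
    ≈⟨ ⊗-congʳ X⁻¹ {S² ⊗ c ⊖ Y ⊗ (S² ⊗ s)} {S² ⊗ c ⊖ S² ⊗ (Y ⊗ s)} (⊖-cong {S² ⊗ c} {S² ⊗ c} {Y ⊗ (S² ⊗ s)} {S² ⊗ (Y ⊗ s)} (≈-refl {S² ⊗ c}) (x⊗yz≈y⊗xz Y S² s)) ⟩
  X⁻¹ ⊗ (S² ⊗ c ⊖ S² ⊗ (Y ⊗ s))
    ≈⟨ ⊗-congʳ X⁻¹ {S² ⊗ c ⊖ S² ⊗ (Y ⊗ s)} {S² ⊗ (c ⊖ Y ⊗ s)} (≈-sym {S² ⊗ (c ⊖ Y ⊗ s)} {S² ⊗ c ⊖ S² ⊗ (Y ⊗ s)} (⊗-distribˡ-⊖ S² c (Y ⊗ s))) ⟩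
  X⁻¹ ⊗ (S² ⊗ (c ⊖ Y ⊗ s))
    ≈⟨ x⊗yz≈y⊗xz X⁻¹ S² (c ⊖ Y ⊗ s) ⟩
  S² ⊗ RHS n
    ∎
  where
  open ≈-Reasoning
  c = coshTS n
  s = sinhTS/S n

theorem2p3 : ∀ n → Gen X⁻¹ n ≈ RHS n
theorem2p3 zero          = ≈-refl {X⁻¹}
theorem2p3 (suc zero)    = DX⁻¹≈RHS1
theorem2p3 (suc (suc n)) = begin
  Dⁿ (suc (suc n)) X⁻¹  ≡⟨ trans (cong D (Dⁿ-suc n X⁻¹)) (Dⁿ-suc n (D X⁻¹)) ⟩
  Dⁿ n (D (D X⁻¹))      ≈⟨ Dⁿ-cong n {D (D X⁻¹)} {S² ⊗ X⁻¹} DDX⁻¹≈S²⊗X⁻¹ ⟩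
  Dⁿ n (S² ⊗ X⁻¹)       ≈⟨ Dⁿ-S²⊗ n X⁻¹ ⟩
  S² ⊗ Dⁿ n X⁻¹         ≈⟨ ⊗-congʳ S² {Dⁿ n X⁻¹} {RHS n} (theorem2p3 n) ⟩
  S² ⊗ RHS n            ≈⟨ RHS-step n ⟨
  RHS (suc (suc n))     ∎
  where open ≈-Reasoning
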